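{- Let $\{V_j\}_{j\ge1}$ be a sequence of positive integers with $V_j=V_{j-1}+V_{j-2}$ for $j\ge3$, let $n\ge1$ and let $d\ge2$ be even, with $\gcd(V_1,V_2)=\gcd(V_n,F_d)=1$. For $k\ge1$ define \[ A_k=\sum_{x=1}^{F_{(k+1)d}/F_d-1}s(x),\qquad B_k=\sum_{x=1}^{(F_{(k+1)d}-F_{kd})/F_d-1}s(x). \] Then for all $k\ge1$, \[ A_{k+1}=(L_d-1)A_k+B_k+(L_d-1)V_{n+(k+1)d}\frac{F_{(k+2)d}-F_{kd}}{2F_d}, \] \[ B_{k+1}=(L_d-2)A_k+B_k+(L_d-2)V_{n+(k+1)d}\frac{F_{(k+2)d}-F_{(k+1)d}-F_{kd}}{2F_d}, \] with $A_1=\tfrac12V_{n+d}L_d(L_d-1)$ and $B_1=\tfrac12V_{n+d}(L_d-1)(L_d-2)$.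
   Context: $F_j$ and $L_j$ are the Fibonacci and Lucas numbers ($F_0=0,F_1=F_2=1$; $L_0=2,L_1=1,L_2=3$; both satisfy $X_j=X_{j-1}+X_{j-2}$); $F_d\mid F_{jd}$ for $j\ge1$. The function $s$ is defined for a positive integer $x$ as follows: let $k\ge1$ satisfy $F_{kd}/F_d\le x<F_{(k+1)d}/F_d$; set $\lambda_k=\lfloor x/(F_{kd}/F_d)\rfloor$ and, for $j=k-1,\ldots,1$, $\lambda_j=\left\lfloor \big(x-\sum_{i=j+1}^k\lambda_iF_{id}/F_d\big)/(F_{jd}/F_d)\right\rfloor$; then $s(x)=\sum_{i=1}^k\lambda_iV_{n+id}$. -}

module Defs where

open import Data.Nat using (ℕ; zero; suc; _+_; _*_; _∸_; _≤?_)
open import Data.Nat.DivMod using (_/_)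
open import Relation.Nullary using (yes; no)

F : ℕ → ℕ
F zero = 0
F (suc zero) = 1
F (suc (suc j)) = F (suc j) + F j

L : ℕ → ℕ
L zero = 2
L (suc zero) = 1
L (suc (suc j)) = L (suc j) + L j

-- floor division, with the (never used here) convention r / 0 = 0
quot : ℕ → ℕ → ℕ
quot r zero = 0
quot r (suc g) = r / suc g

-- G d j = F_{jd} / F_d  (an exact quotient since F_d ∣ F_{jd})
G : ℕ → ℕ → ℕ
G d j = quot (F (j * d)) (F d)

-- With fuel x and start 1 this returns the k ≥ 1 with G_k ≤ x < G_{k+1}
-- (for d ≥ 2 the G_j are strictly increasing and G_{x+1} > x, so fuel x suffices).
findK : ℕ → ℕ → ℕ → ℕ → ℕ
findK d x zero j = j
findK d x (suc fuel) j with G d (suc j) ≤? x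
... | yes _ = findK d x fuel (suc j)
... | no  _ = j

kOf : ℕ → ℕ → ℕ
kOf d x = findK d x x 1

-- greedy V j r : given the current residue r = x - Σ_{i>j} λ_i F_{id}/F_d,
-- returns Σ_{i=1}^{j} λ_i V_{n+id}, with λ_j = ⌊ r / (F_{jd}/F_d) ⌋.
greedy : (ℕ → ℕ) → ℕ → ℕ → ℕ → ℕ → ℕ
greedy V n d zero r = 0
greedy V n d (suc j) r =
  let λj = quot r (G d (suc j)) in
  λj * V (n + suc j * d) + greedy V n d j (r ∸ λj * G d (suc j))

s : (ℕ → ℕ) → ℕ → ℕ → ℕ → ℕ
s V n d x = greedy V n d (kOf d x) x

sum1 : (ℕ → ℕ) → ℕ → ℕ
sum1 f zero = 0
sum1 f (suc N) = sum1 f N + f (suc N)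

A : (ℕ → ℕ) → ℕ → ℕ → ℕ → ℕ
A V n d k = sum1 (s V n d) (quot (F (suc k * d)) (F d) ∸ 1)

B : (ℕ → ℕ) → ℕ → ℕ → ℕ → ℕ
B V n d k = sum1 (s V n d) (quot (F (suc k * d) ∸ F (k * d)) (F d) ∸ 1)

{-# OPTIONS --safe #-}
-- For even d, F (m + 2d) + F m = L d · F (m + d), so G j = F (j d) / F d is the Lucas sequence
-- U j (L d, 1), i.e. G (j + 2) = L d · G (j + 1) − G j, strictly increasing since L d ≥ 3.
-- For r < G (k + 1) the greedy expansion gives s (q · G (k + 1) + r) = q · V (n + (k + 1) d) + s r.
-- As G (k + 2) = (L d − 1) · G (k + 1) + (G (k + 1) − G k), the range of A (k + 1) splits into
-- L d − 1 blocks of length G (k + 1), the i-th summing to A k + i · G (k + 1) · V (n + (k + 1) d),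
-- and a last block of length G (k + 1) − G k summing to B k plus a multiple of V (n + (k + 1) d);
-- the range of B (k + 1) is the same with L d − 2 full blocks.  The recurrences already hold at
-- k = 0, where A 0 = B 0 = 0, and that instance gives A 1 and B 1.
module Submission where

open import Defs
open import Data.List using ([]; _∷_)
open import Data.Nat using (ℕ; zero; suc; _+_; _*_; _∸_; _≤_; _<_; _≤?_; _≤′_; ≤′-refl; ≤′-step; z≤n; s≤s)
open import Data.Nat.DivMod using (_/_; m*n/n≡m; m<n⇒m/n≡0; +-distrib-/-∣ˡ)
open import Data.Nat.Divisibility using (divides)
open import Data.Nat.GCD using (gcd)
open import Data.Nat.Properties
open import Algebra.Properties.CommutativeSemigroup *-commutativeSemigroup using (x∙yz≈y∙xz)
open import Data.Nat.Tactic.RingSolver using (solve; solve-∀)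
open import Data.Product using (_×_; _,_; ∃)
open import Data.Sum using (inj₁; inj₂)
open import Relation.Nullary using (yes; no)
open import Relation.Binary.PropositionalEquality

F-+ : ∀ a b → F (suc (a + b)) ≡ F (suc a) * F (suc b) + F a * F b
F-+ zero b = sym (trans (+-identityʳ _) (+-identityʳ _))
F-+ (suc a) b = begin
  F (suc (suc a + b))                              ≡⟨ cong (λ m → F (suc m)) (sym (+-suc a b)) ⟩
  F (suc (a + suc b))                              ≡⟨ F-+ a (suc b) ⟩
  F (suc a) * (F (suc b) + F b) + F a * F (suc b)  ≡⟨ regroup (F (suc a)) (F a) (F (suc b)) (F b) ⟩
  (F (suc a) + F a) * F (suc b) + F (suc a) * F b  ∎
  where
  open ≡-Reasoning
  regroup : ∀ p q r s → p * (r + s) + q * r ≡ (p + q) * r + p * s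
  regroup = solve-∀

L-suc : ∀ e → L (suc e) ≡ F (suc (suc e)) + F e
L-suc zero = refl
L-suc (suc zero) = refl
L-suc (suc (suc e)) = begin
  L (suc (suc e)) + L (suc e)                                    ≡⟨ cong₂ _+_ (L-suc (suc e)) (L-suc e) ⟩
  F (suc (suc (suc e))) + F (suc e) + (F (suc (suc e)) + F e)    ≡⟨ +-comm-middle (F (suc (suc (suc e)))) (F (suc e)) (F (suc (suc e))) (F e) ⟩
  F (suc (suc (suc e))) + F (suc (suc e)) + (F (suc e) + F e)    ∎
  where
  open ≡-Reasoning
  +-comm-middle : ∀ p q r s → p + q + (r + s) ≡ p + r + (q + s)
  +-comm-middle = solve-∀

-- d'Ocagne's identity F (d + 1) F (d + a) − F (d + a + 1) F d = (−1)^d F a, one equation per sign.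
DOcagne⁺ DOcagne⁻ : ℕ → ℕ → Set
DOcagne⁺ d a = F (suc (d + a)) * F d + F a ≡ F (suc d) * F (d + a)
DOcagne⁻ d a = F (suc (d + a)) * F d ≡ F (suc d) * F (d + a) + F a

DOcagne⁺⇒DOcagne⁻ : ∀ d a → DOcagne⁺ d a → DOcagne⁻ (suc d) a
DOcagne⁺⇒DOcagne⁻ d a = step (F (suc (d + a))) (F (d + a)) (F (suc d)) (F d) (F a)
  where
  open ≡-Reasoning
  step : ∀ x y p q z → x * q + z ≡ p * y → (x + y) * p ≡ (p + q) * x + z
  step x y p q z eq = begin
    (x + y) * p          ≡⟨ solve (x ∷ y ∷ p ∷ []) ⟩
    x * p + p * y        ≡⟨ cong (x * p +_) (sym eq) ⟩
    x * p + (x * q + z)  ≡⟨ solve (x ∷ p ∷ q ∷ z ∷ []) ⟩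
    (p + q) * x + z      ∎

DOcagne⁻⇒DOcagne⁺ : ∀ d a → DOcagne⁻ d a → DOcagne⁺ (suc d) a
DOcagne⁻⇒DOcagne⁺ d a = step (F (suc (d + a))) (F (d + a)) (F (suc d)) (F d) (F a)
  where
  open ≡-Reasoning
  step : ∀ x y p q z → x * q ≡ p * y + z → (x + y) * p + z ≡ (p + q) * x
  step x y p q z eq = begin
    (x + y) * p + z      ≡⟨ solve (x ∷ y ∷ p ∷ z ∷ []) ⟩
    x * p + (p * y + z)  ≡⟨ cong (x * p +_) (sym eq) ⟩
    x * p + x * q        ≡⟨ solve (x ∷ p ∷ q ∷ []) ⟩
    (p + q) * x          ∎

dOcagne-even : ∀ m a → DOcagne⁺ (2 * m) a
dOcagne-even zero a = trans (cong (_+ F a) (*-zeroʳ (F (suc a)))) (sym (+-identityʳ (F a)))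
dOcagne-even (suc m) a = subst (λ d → DOcagne⁺ d a) (sym (*-suc 2 m))
  (DOcagne⁻⇒DOcagne⁺ (suc (2 * m)) a (DOcagne⁺⇒DOcagne⁻ (2 * m) a (dOcagne-even m a)))

DOcagne⁺⇒F-shift : ∀ e a → DOcagne⁺ (suc e) a →
                   F (suc e + (suc e + a)) + F a ≡ L (suc e) * F (suc e + a)
DOcagne⁺⇒F-shift e a dOcagne = begin
  F (suc e + (suc e + a)) + F a
    ≡⟨ cong (_+ F a) (F-+ e (suc e + a)) ⟩
  F (suc e) * F (suc (suc e + a)) + F e * F (suc e + a) + F a
    ≡⟨ regroup (F (suc e)) (F (suc (suc e + a))) (F e * F (suc e + a)) (F a) ⟩
  F (suc (suc e + a)) * F (suc e) + F a + F e * F (suc e + a)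
    ≡⟨ cong (_+ F e * F (suc e + a)) dOcagne ⟩
  F (suc (suc e)) * F (suc e + a) + F e * F (suc e + a)
    ≡⟨ sym (*-distribʳ-+ (F (suc e + a)) (F (suc (suc e))) (F e)) ⟩
  (F (suc (suc e)) + F e) * F (suc e + a)
    ≡⟨ cong (_* F (suc e + a)) (sym (L-suc e)) ⟩
  L (suc e) * F (suc e + a)
    ∎
  where
  open ≡-Reasoning
  regroup : ∀ p x y z → p * x + y + z ≡ x * p + z + y
  regroup = solve-∀

F-shift-even : ∀ {d} → ∃ (λ m → d ≡ 2 * m) → ∀ a → F (d + (d + a)) + F a ≡ L d * F (d + a)
F-shift-even (zero , refl) a = cong (F a +_) (sym (+-identityʳ (F a)))
F-shift-even (suc m , refl) a = DOcagne⁺⇒F-shift (m + suc (m + 0)) a (dOcagne-even (suc m) a)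

0<F : ∀ {d} → 1 ≤ d → 0 < F d
0<F {1} _ = s≤s z≤n
0<F {suc (suc d)} _ = ≤-trans (0<F {suc d} (s≤s z≤n)) (m≤m+n (F (suc d)) (F d))

3≤L : ∀ {d} → 2 ≤ d → 3 ≤ L d
3≤L {2} _ = ≤-refl
3≤L {suc (suc (suc d))} _ = ≤-trans (3≤L {suc (suc d)} (s≤s (s≤s z≤n))) (m≤m+n (L (suc (suc d))) (L (suc d)))
3≤L {1} (s≤s ())

-- U j (c, 1); the truncated subtraction is exact once c ≥ 2 (lucasU-rec).
lucasU : ℕ → ℕ → ℕ
lucasU c zero = 0
lucasU c (suc zero) = 1
lucasU c (suc (suc j)) = c * lucasU c (suc j) ∸ lucasU c j

module _ {c : ℕ} (2≤c : 2 ≤ c) where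

  lucasU-< : ∀ j → lucasU c j < lucasU c (suc j)
  lucasU-< zero = s≤s z≤n
  lucasU-< (suc j) = m+n≤o⇒m≤o∸n (suc x) (begin
    suc x + y  ≡⟨ sym (+-suc x y) ⟩
    x + suc y  ≤⟨ +-monoʳ-≤ x (lucasU-< j) ⟩
    x + x      ≡⟨ cong (x +_) (sym (+-identityʳ x)) ⟩
    2 * x      ≤⟨ *-monoˡ-≤ x 2≤c ⟩
    c * x      ∎)
    where
    open ≤-Reasoning
    x = lucasU c (suc j)
    y = lucasU c j

  lucasU-rec : ∀ j → lucasU c (suc (suc j)) + lucasU c j ≡ c * lucasU c (suc j)
  lucasU-rec j = m∸n+n≡m (≤-trans (<⇒≤ (lucasU-< j)) (≤-trans (m≤m+n x (x + 0)) (*-monoˡ-≤ x 2≤c)))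
    where
    x = lucasU c (suc j)

F-*-lucasU : ∀ {d} → (∀ a → F (d + (d + a)) + F a ≡ L d * F (d + a)) →
             ∀ j → F (j * d) ≡ F d * lucasU (L d) j
F-*-lucasU {d} shift zero = sym (*-zeroʳ (F d))
F-*-lucasU {d} shift (suc zero) = trans (cong F (+-identityʳ d)) (sym (*-identityʳ (F d)))
F-*-lucasU {d} shift (suc (suc j)) = begin
  F (d + (d + j * d))                          ≡⟨ sym (m+n∸n≡m _ (F (j * d))) ⟩
  F (d + (d + j * d)) + F (j * d) ∸ F (j * d)  ≡⟨ cong (_∸ F (j * d)) (shift (j * d)) ⟩
  L d * F (suc j * d) ∸ F (j * d)              ≡⟨ cong₂ (λ x y → L d * x ∸ y) (F-*-lucasU {d} shift (suc j)) (F-*-lucasU {d} shift j) ⟩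
  L d * (F d * U (suc j)) ∸ F d * U j          ≡⟨ cong (_∸ F d * U j) (x∙yz≈y∙xz (L d) (F d) (U (suc j))) ⟩
  F d * (L d * U (suc j)) ∸ F d * U j          ≡⟨ sym (*-distribˡ-∸ (F d) (L d * U (suc j)) (U j)) ⟩
  F d * (L d * U (suc j) ∸ U j)                ∎
  where
  open ≡-Reasoning
  U = lucasU (L d)

[1+q]*m+n∸m≡q*m+n : ∀ q m n → suc q * m + n ∸ m ≡ q * m + n
[1+q]*m+n∸m≡q*m+n q m n = trans (cong (_∸ m) (+-assoc m (q * m) n)) (m+n∸m≡n m (q * m + n))

module _ (t : ℕ) where
  private
    U = lucasU (3 + t)
    U-≤ : ∀ j → U j ≤ U (suc j)
    U-≤ j = <⇒≤ (lucasU-< (s≤s (s≤s z≤n)) j)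

  lucasU-2+ : ∀ j → U (2 + j) ≡ (2 + t) * U (1 + j) + (U (1 + j) ∸ U j)
  lucasU-2+ j = +-cancelʳ-≡ a (U (2 + j)) ((2 + t) * H + b) (begin
    U (2 + j) + a          ≡⟨ lucasU-rec (s≤s (s≤s z≤n)) j ⟩
    (3 + t) * H            ≡⟨ +-comm H ((2 + t) * H) ⟩
    (2 + t) * H + H        ≡⟨ cong ((2 + t) * H +_) (sym (m∸n+n≡m (U-≤ j))) ⟩
    (2 + t) * H + (b + a)  ≡⟨ sym (+-assoc ((2 + t) * H) b a) ⟩
    (2 + t) * H + b + a    ∎)
    where
    open ≡-Reasoning
    a = U j
    H = U (1 + j)
    b = H ∸ a

  lucasU-2+∸1+ : ∀ j → U (2 + j) ∸ U (1 + j) ≡ (1 + t) * U (1 + j) + (U (1 + j) ∸ U j)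
  lucasU-2+∸1+ j = trans (cong (_∸ U (1 + j)) (lucasU-2+ j)) ([1+q]*m+n∸m≡q*m+n (1 + t) (U (1 + j)) (U (1 + j) ∸ U j))

  lucasU-2+∸ : ∀ j → U (2 + j) ∸ U j ≡ (1 + t) * U (1 + j) + 2 * (U (1 + j) ∸ U j)
  lucasU-2+∸ j = trans (cong (_∸ a) U[2+j]≡) (m+n∸m≡n a ((1 + t) * H + 2 * b))
    where
    open ≡-Reasoning
    a = U j
    H = U (1 + j)
    b = H ∸ a
    regroup : ∀ a b x → b + a + (x + b) ≡ a + (x + 2 * b)
    regroup = solve-∀
    U[2+j]≡ : U (2 + j) ≡ a + ((1 + t) * H + 2 * b)
    U[2+j]≡ = begin
      U (2 + j)                  ≡⟨ lucasU-2+ j ⟩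
      (2 + t) * H + b            ≡⟨ +-assoc H ((1 + t) * H) b ⟩
      H + ((1 + t) * H + b)      ≡⟨ cong (_+ ((1 + t) * H + b)) (sym (m∸n+n≡m (U-≤ j))) ⟩
      b + a + ((1 + t) * H + b)  ≡⟨ regroup a b ((1 + t) * H) ⟩
      a + ((1 + t) * H + 2 * b)  ∎

  lucasU-2+∸1+∸ : ∀ j → U (2 + j) ∸ U (1 + j) ∸ U j ≡ t * U (1 + j) + 2 * (U (1 + j) ∸ U j)
  lucasU-2+∸1+∸ j = begin
    U (2 + j) ∸ H ∸ a            ≡⟨ ∸-+-assoc (U (2 + j)) H a ⟩
    U (2 + j) ∸ (H + a)          ≡⟨ cong (U (2 + j) ∸_) (+-comm H a) ⟩
    U (2 + j) ∸ (a + H)          ≡⟨ sym (∸-+-assoc (U (2 + j)) a H) ⟩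
    U (2 + j) ∸ a ∸ H            ≡⟨ cong (_∸ H) (lucasU-2+∸ j) ⟩
    (1 + t) * H + 2 * b ∸ H      ≡⟨ [1+q]*m+n∸m≡q*m+n t H (2 * b) ⟩
    t * H + 2 * b                ∎
    where
    open ≡-Reasoning
    a = U j
    H = U (1 + j)
    b = H ∸ a

quot-*ˡ : ∀ {y} x → 0 < y → quot (y * x) y ≡ x
quot-*ˡ {suc y} x _ = trans (cong (_/ suc y) (*-comm (suc y) x)) (m*n/n≡m x (suc y))

quot-*+ : ∀ q {r y} → r < y → quot (q * y + r) y ≡ q
quot-*+ q {r} {suc y} r<y = begin
  (q * suc y + r) / suc y        ≡⟨ +-distrib-/-∣ˡ r (divides q refl) ⟩
  q * suc y / suc y + r / suc y  ≡⟨ cong₂ _+_ (m*n/n≡m q (suc y)) (m<n⇒m/n≡0 r<y) ⟩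
  q + 0                          ≡⟨ +-identityʳ q ⟩
  q                              ∎
  where open ≡-Reasoning

sumBelow : (ℕ → ℕ) → ℕ → ℕ
sumBelow f zero = 0
sumBelow f (suc N) = sumBelow f N + f N

sum1≡sumBelow-suc : ∀ f → f 0 ≡ 0 → ∀ N → sum1 f N ≡ sumBelow f (suc N)
sum1≡sumBelow-suc f f0≡0 zero = sym f0≡0
sum1≡sumBelow-suc f f0≡0 (suc N) = cong (_+ f (suc N)) (sum1≡sumBelow-suc f f0≡0 N)

sum1-pred≡sumBelow : ∀ f → f 0 ≡ 0 → ∀ N → sum1 f (N ∸ 1) ≡ sumBelow f N
sum1-pred≡sumBelow f f0≡0 zero = refl
sum1-pred≡sumBelow f f0≡0 (suc N) = sum1≡sumBelow-suc f f0≡0 N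

sumBelow-cong : ∀ {f g} N → (∀ x → x < N → f x ≡ g x) → sumBelow f N ≡ sumBelow g N
sumBelow-cong zero f≗g = refl
sumBelow-cong (suc N) f≗g =
  cong₂ _+_ (sumBelow-cong N (λ x x<N → f≗g x (m≤n⇒m≤1+n x<N))) (f≗g N ≤-refl)

2*sumBelow-id : ∀ p → 2 * sumBelow (λ i → i) (suc p) ≡ suc p * p
2*sumBelow-id zero = refl
2*sumBelow-id (suc p) = begin
  2 * (T + suc p)        ≡⟨ *-distribˡ-+ 2 T (suc p) ⟩
  2 * T + 2 * suc p      ≡⟨ cong (_+ 2 * suc p) (2*sumBelow-id p) ⟩
  suc p * p + 2 * suc p  ≡⟨ solve (p ∷ []) ⟩
  suc (suc p) * suc p    ∎
  where
  open ≡-Reasoning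
  T = sumBelow (λ i → i) (suc p)

module Blocks (f e : ℕ → ℕ) (H v : ℕ)
              (f-block : ∀ q r → r < H → f (q * H + r) ≡ q * v + e r) where

  sumBelow-partial : ∀ q r → r ≤ H →
                     sumBelow f (q * H + r) ≡ sumBelow f (q * H) + (r * (q * v) + sumBelow e r)
  sumBelow-partial q zero _ = trans (cong (sumBelow f) (+-identityʳ (q * H))) (sym (+-identityʳ _))
  sumBelow-partial q (suc r) r<H = begin
    sumBelow f (q * H + suc r)
      ≡⟨ cong (sumBelow f) (+-suc (q * H) r) ⟩
    sumBelow f (q * H + r) + f (q * H + r)
      ≡⟨ cong₂ _+_ (sumBelow-partial q r (<⇒≤ r<H)) (f-block q r r<H) ⟩
    sumBelow f (q * H) + (r * (q * v) + sumBelow e r) + (q * v + e r)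
      ≡⟨ regroup (sumBelow f (q * H)) r (q * v) (sumBelow e r) (e r) ⟩
    sumBelow f (q * H) + (suc r * (q * v) + (sumBelow e r + e r))
      ∎
    where
    open ≡-Reasoning
    regroup : ∀ x r w y z → x + (r * w + y) + (w + z) ≡ x + ((1 + r) * w + (y + z))
    regroup = solve-∀

  sumBelow-blocks : ∀ q → sumBelow f (q * H) ≡ q * sumBelow e H + sumBelow (λ i → i) q * (v * H)
  sumBelow-blocks zero = refl
  sumBelow-blocks (suc q) = begin
    sumBelow f (H + q * H)
      ≡⟨ cong (sumBelow f) (+-comm H (q * H)) ⟩
    sumBelow f (q * H + H)
      ≡⟨ sumBelow-partial q H ≤-refl ⟩
    sumBelow f (q * H) + (H * (q * v) + S)
      ≡⟨ cong (_+ (H * (q * v) + S)) (sumBelow-blocks q) ⟩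
    q * S + T * (v * H) + (H * (q * v) + S)
      ≡⟨ regroup q S T v H ⟩
    suc q * S + (T + q) * (v * H)
      ∎
    where
    open ≡-Reasoning
    S = sumBelow e H
    T = sumBelow (λ i → i) q
    regroup : ∀ q S T v H → q * S + T * (v * H) + (H * (q * v) + S) ≡ (1 + q) * S + (T + q) * (v * H)
    regroup = solve-∀

  2*sumBelow : ∀ p r → r ≤ H →
               2 * sumBelow f (suc p * H + r)
                 ≡ 2 * (suc p * sumBelow e H + sumBelow e r) + suc p * v * (p * H + 2 * r)
  2*sumBelow p r r≤H = begin
    2 * sumBelow f (suc p * H + r)
      ≡⟨ cong (2 *_) (sumBelow-partial (suc p) r r≤H) ⟩
    2 * (sumBelow f (suc p * H) + (r * (suc p * v) + Sr))
      ≡⟨ cong (λ x → 2 * (x + (r * (suc p * v) + Sr))) (sumBelow-blocks (suc p)) ⟩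
    2 * (suc p * SH + T * (v * H) + (r * (suc p * v) + Sr))
      ≡⟨ expand p SH T v H r Sr ⟩
    2 * (suc p * SH + Sr) + 2 * T * (v * H) + 2 * r * (suc p * v)
      ≡⟨ cong (λ x → 2 * (suc p * SH + Sr) + x * (v * H) + 2 * r * (suc p * v)) (2*sumBelow-id p) ⟩
    2 * (suc p * SH + Sr) + suc p * p * (v * H) + 2 * r * (suc p * v)
      ≡⟨ collect p SH Sr v H r ⟩
    2 * (suc p * SH + Sr) + suc p * v * (p * H + 2 * r)
      ∎
    where
    open ≡-Reasoning
    SH = sumBelow e H
    Sr = sumBelow e r
    T = sumBelow (λ i → i) (suc p)
    expand : ∀ p SH T v H r Sr →
             2 * ((1 + p) * SH + T * (v * H) + (r * ((1 + p) * v) + Sr))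
               ≡ 2 * ((1 + p) * SH + Sr) + 2 * T * (v * H) + 2 * r * ((1 + p) * v)
    expand = solve-∀
    collect : ∀ p SH Sr v H r →
              2 * ((1 + p) * SH + Sr) + (1 + p) * p * (v * H) + 2 * r * ((1 + p) * v)
                ≡ 2 * ((1 + p) * SH + Sr) + (1 + p) * v * (p * H + 2 * r)
    collect = solve-∀

greedy-*+ : ∀ {V n d} j q {r} → r < G d (suc j) →
            greedy V n d (suc j) (q * G d (suc j) + r) ≡ q * V (n + suc j * d) + greedy V n d j r
greedy-*+ {d = d} j q {r} r<G rewrite quot-*+ q r<G | m+n∸m≡n (q * G d (suc j)) r = refl

module Greedy (V : ℕ → ℕ) (n d : ℕ) (G-< : ∀ j → G d j < G d (suc j)) where

  G-mono-≤ : ∀ {i j} → i ≤′ j → G d i ≤ G d j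
  G-mono-≤ ≤′-refl = ≤-refl
  G-mono-≤ {j = suc j} (≤′-step i≤′j) = ≤-trans (G-mono-≤ i≤′j) (<⇒≤ (G-< j))

  ≤G : ∀ j → j ≤ G d j
  ≤G zero = z≤n
  ≤G (suc j) = ≤-trans (s≤s (≤G j)) (G-< j)

  -- Each level above j has digit 0, since x < G d (suc j) ≤ G d (suc K): greedy-*+ with q = 0.
  greedy-stable : ∀ {j K x} → j ≤′ K → x < G d (suc j) → greedy V n d K x ≡ greedy V n d j x
  greedy-stable ≤′-refl _ = refl
  greedy-stable {K = suc K} (≤′-step j≤′K) x<G =
    trans (greedy-*+ K 0 (≤-trans x<G (G-mono-≤ (s≤′s j≤′K)))) (greedy-stable j≤′K x<G)

  findK-bound : ∀ {x} fuel j → x < j + fuel → x < G d (suc (findK d x fuel j))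
  findK-bound {x} zero j x<j+0 = <-trans (<-≤-trans (subst (x <_) (+-identityʳ j) x<j+0) (≤G j)) (G-< j)
  findK-bound {x} (suc fuel) j x<j+1+fuel with G d (suc j) ≤? x
  ... | yes _ = findK-bound fuel (suc j) (subst (x <_) (+-suc j fuel) x<j+1+fuel)
  ... | no G≰x = ≰⇒> G≰x

  s≡greedy : ∀ {K x} → x < G d (suc K) → s V n d x ≡ greedy V n d K x
  s≡greedy {K} {x} x<G with ≤-total (kOf d x) K
  ... | inj₁ k≤K = sym (greedy-stable (≤⇒≤′ k≤K) (findK-bound x 1 ≤-refl))
  ... | inj₂ K≤k = greedy-stable (≤⇒≤′ K≤k) x<G

  sumBelow-s≡greedy : ∀ K {N} → N ≤ G d (suc K) → sumBelow (s V n d) N ≡ sumBelow (greedy V n d K) N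
  sumBelow-s≡greedy K {N} N≤G = sumBelow-cong N (λ x x<N → s≡greedy {K} (<-≤-trans x<N N≤G))

  sum1-s-pred : ∀ N → sum1 (s V n d) (N ∸ 1) ≡ sumBelow (s V n d) N
  sum1-s-pred = sum1-pred≡sumBelow (s V n d) (s≡greedy {0} (≤-trans (s≤s z≤n) (G-< 0)))

scale-recurrence : ∀ c q y z v {x w} → 2 * x ≡ 2 * (q * y + z) + q * v * w →
                   2 * c * x ≡ 2 * c * (q * y + z) + q * v * (c * w)
scale-recurrence c q y z v {x} {w} eq = begin
  2 * c * x                                  ≡⟨ solve (c ∷ x ∷ []) ⟩
  c * (2 * x)                                ≡⟨ cong (c *_) eq ⟩
  c * (2 * (q * y + z) + q * v * w)          ≡⟨ solve (c ∷ q ∷ y ∷ z ∷ v ∷ w ∷ []) ⟩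
  2 * c * (q * y + z) + q * v * (c * w)      ∎
  where open ≡-Reasoning

module Recurrences (V : ℕ → ℕ) (n d : ℕ) (2≤d : 2 ≤ d) (d-even : ∃ (λ m → d ≡ 2 * m)) where

  t : ℕ
  t = L d ∸ 3

  L[d]≡3+t : L d ≡ 3 + t
  L[d]≡3+t = sym (m+[n∸m]≡n (3≤L 2≤d))

  U : ℕ → ℕ
  U = lucasU (3 + t)

  F-*d : ∀ j → F (j * d) ≡ F d * U j
  F-*d j = subst (λ c → F (j * d) ≡ F d * lucasU c j) L[d]≡3+t (F-*-lucasU (F-shift-even d-even) j)

  F-*d∸ : ∀ i j → F (i * d) ∸ F (j * d) ≡ F d * (U i ∸ U j)
  F-*d∸ i j = trans (cong₂ _∸_ (F-*d i) (F-*d j)) (sym (*-distribˡ-∸ (F d) (U i) (U j)))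

  0<F[d] : 0 < F d
  0<F[d] = 0<F (≤-trans (s≤s z≤n) 2≤d)

  G≡U : ∀ j → G d j ≡ U j
  G≡U j = trans (cong (λ x → quot x (F d)) (F-*d j)) (quot-*ˡ (U j) 0<F[d])

  open Greedy V n d (λ j → subst₂ _<_ (sym (G≡U j)) (sym (G≡U (suc j))) (lucasU-< (s≤s (s≤s z≤n)) j))

  S : ℕ → ℕ → ℕ
  S k = sumBelow (greedy V n d k)

  A≡S : ∀ k → A V n d k ≡ S k (U (suc k))
  A≡S k = begin
    A V n d k                         ≡⟨ sum1-s-pred (G d (suc k)) ⟩
    sumBelow (s V n d) (G d (suc k))  ≡⟨ cong (sumBelow (s V n d)) (G≡U (suc k)) ⟩
    sumBelow (s V n d) (U (suc k))    ≡⟨ sumBelow-s≡greedy k (≤-reflexive (sym (G≡U (suc k)))) ⟩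
    S k (U (suc k))                   ∎
    where open ≡-Reasoning

  B≡S : ∀ k → B V n d k ≡ S k (U (suc k) ∸ U k)
  B≡S k = begin
    B V n d k                                     ≡⟨ sum1-s-pred (quot (F (suc k * d) ∸ F (k * d)) (F d)) ⟩
    sumBelow (s V n d) (quot (F (suc k * d) ∸ F (k * d)) (F d))
      ≡⟨ cong (λ x → sumBelow (s V n d) (quot x (F d))) (F-*d∸ (suc k) k) ⟩
    sumBelow (s V n d) (quot (F d * (U (suc k) ∸ U k)) (F d))
      ≡⟨ cong (sumBelow (s V n d)) (quot-*ˡ (U (suc k) ∸ U k) 0<F[d]) ⟩
    sumBelow (s V n d) (U (suc k) ∸ U k)
      ≡⟨ sumBelow-s≡greedy k (≤-trans (m∸n≤m (U (suc k)) (U k)) (≤-reflexive (sym (G≡U (suc k))))) ⟩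
    S k (U (suc k) ∸ U k)                         ∎
    where open ≡-Reasoning

  greedy-block : ∀ k q r → r < U (suc k) →
                 greedy V n d (suc k) (q * U (suc k) + r) ≡ q * V (n + suc k * d) + greedy V n d k r
  greedy-block k q r rewrite sym (G≡U (suc k)) = greedy-*+ k q

  module Level (k : ℕ) = Blocks (greedy V n d (suc k)) (greedy V n d k) (U (suc k)) (V (n + suc k * d))
                                (greedy-block k)

  2*A-suc : ∀ k → 2 * A V n d (suc k)
                    ≡ 2 * ((2 + t) * A V n d k + B V n d k)
                      + (2 + t) * V (n + suc k * d) * ((1 + t) * U (suc k) + 2 * (U (suc k) ∸ U k))
  2*A-suc k = begin
    2 * A V n d (suc k)
      ≡⟨ cong (2 *_) (A≡S (suc k)) ⟩
    2 * S (suc k) (U (2 + k))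
      ≡⟨ cong (λ N → 2 * S (suc k) N) (lucasU-2+ t k) ⟩
    2 * S (suc k) ((2 + t) * U (suc k) + (U (suc k) ∸ U k))
      ≡⟨ Level.2*sumBelow k (1 + t) (U (suc k) ∸ U k) (m∸n≤m (U (suc k)) (U k)) ⟩
    2 * ((2 + t) * S k (U (suc k)) + S k (U (suc k) ∸ U k))
      + (2 + t) * V (n + suc k * d) * ((1 + t) * U (suc k) + 2 * (U (suc k) ∸ U k))
      ≡⟨ cong (_+ rest) (cong₂ (λ x y → 2 * ((2 + t) * x + y)) (sym (A≡S k)) (sym (B≡S k))) ⟩
    2 * ((2 + t) * A V n d k + B V n d k)
      + (2 + t) * V (n + suc k * d) * ((1 + t) * U (suc k) + 2 * (U (suc k) ∸ U k))
      ∎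
    where
    open ≡-Reasoning
    rest = (2 + t) * V (n + suc k * d) * ((1 + t) * U (suc k) + 2 * (U (suc k) ∸ U k))

  2*B-suc : ∀ k → 2 * B V n d (suc k)
                    ≡ 2 * ((1 + t) * A V n d k + B V n d k)
                      + (1 + t) * V (n + suc k * d) * (t * U (suc k) + 2 * (U (suc k) ∸ U k))
  2*B-suc k = begin
    2 * B V n d (suc k)
      ≡⟨ cong (2 *_) (B≡S (suc k)) ⟩
    2 * S (suc k) (U (2 + k) ∸ U (suc k))
      ≡⟨ cong (λ N → 2 * S (suc k) N) (lucasU-2+∸1+ t k) ⟩
    2 * S (suc k) ((1 + t) * U (suc k) + (U (suc k) ∸ U k))
      ≡⟨ Level.2*sumBelow k t (U (suc k) ∸ U k) (m∸n≤m (U (suc k)) (U k)) ⟩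
    2 * ((1 + t) * S k (U (suc k)) + S k (U (suc k) ∸ U k))
      + (1 + t) * V (n + suc k * d) * (t * U (suc k) + 2 * (U (suc k) ∸ U k))
      ≡⟨ cong (_+ rest) (cong₂ (λ x y → 2 * ((1 + t) * x + y)) (sym (A≡S k)) (sym (B≡S k))) ⟩
    2 * ((1 + t) * A V n d k + B V n d k)
      + (1 + t) * V (n + suc k * d) * (t * U (suc k) + 2 * (U (suc k) ∸ U k))
      ∎
    where
    open ≡-Reasoning
    rest = (1 + t) * V (n + suc k * d) * (t * U (suc k) + 2 * (U (suc k) ∸ U k))

  F-*d∸∸ : ∀ i j l → F (i * d) ∸ F (j * d) ∸ F (l * d) ≡ F d * (U i ∸ U j ∸ U l)
  F-*d∸∸ i j l = trans (cong₂ _∸_ (F-*d∸ i j) (F-*d l)) (sym (*-distribˡ-∸ (F d) (U i ∸ U j) (U l)))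

  A-rec : ∀ k → 2 * F d * A V n d (suc k)
                  ≡ 2 * F d * ((L d ∸ 1) * A V n d k + B V n d k)
                    + (L d ∸ 1) * V (n + suc k * d) * (F (suc (suc k) * d) ∸ F (k * d))
  A-rec k = begin
    2 * F d * A V n d (suc k)
      ≡⟨ scale-recurrence (F d) (2 + t) (A V n d k) (B V n d k) (V (n + suc k * d)) (2*A-suc k) ⟩
    2 * F d * ((2 + t) * A V n d k + B V n d k)
      + (2 + t) * V (n + suc k * d) * (F d * ((1 + t) * U (suc k) + 2 * (U (suc k) ∸ U k)))
      ≡⟨ cong₂ (λ q w → 2 * F d * (q * A V n d k + B V n d k) + q * V (n + suc k * d) * w)
               (cong (_∸ 1) (sym L[d]≡3+t))
               (sym (trans (F-*d∸ (2 + k) k) (cong (F d *_) (lucasU-2+∸ t k)))) ⟩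
    2 * F d * ((L d ∸ 1) * A V n d k + B V n d k)
      + (L d ∸ 1) * V (n + suc k * d) * (F (suc (suc k) * d) ∸ F (k * d))
      ∎
    where open ≡-Reasoning

  B-rec : ∀ k → 2 * F d * B V n d (suc k)
                  ≡ 2 * F d * ((L d ∸ 2) * A V n d k + B V n d k)
                    + (L d ∸ 2) * V (n + suc k * d)
                      * (F (suc (suc k) * d) ∸ F (suc k * d) ∸ F (k * d))
  B-rec k = begin
    2 * F d * B V n d (suc k)
      ≡⟨ scale-recurrence (F d) (1 + t) (A V n d k) (B V n d k) (V (n + suc k * d)) (2*B-suc k) ⟩
    2 * F d * ((1 + t) * A V n d k + B V n d k)
      + (1 + t) * V (n + suc k * d) * (F d * (t * U (suc k) + 2 * (U (suc k) ∸ U k)))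
      ≡⟨ cong₂ (λ q w → 2 * F d * (q * A V n d k + B V n d k) + q * V (n + suc k * d) * w)
               (cong (_∸ 2) (sym L[d]≡3+t))
               (sym (trans (F-*d∸∸ (2 + k) (1 + k) k) (cong (F d *_) (lucasU-2+∸1+∸ t k)))) ⟩
    2 * F d * ((L d ∸ 2) * A V n d k + B V n d k)
      + (L d ∸ 2) * V (n + suc k * d) * (F (suc (suc k) * d) ∸ F (suc k * d) ∸ F (k * d))
      ∎
    where open ≡-Reasoning

  A-zero : A V n d 0 ≡ 0
  A-zero = A≡S 0

  B-zero : B V n d 0 ≡ 0
  B-zero = B≡S 0

  V[n+1*d]≡V[n+d] : V (n + 1 * d) ≡ V (n + d)
  V[n+1*d]≡V[n+d] = cong (λ x → V (n + x)) (*-identityˡ d)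

  2*A-one : 2 * A V n d 1 ≡ V (n + d) * L d * (L d ∸ 1)
  2*A-one = begin
    2 * A V n d 1
      ≡⟨ 2*A-suc 0 ⟩
    2 * ((2 + t) * A V n d 0 + B V n d 0) + (2 + t) * V (n + 1 * d) * ((1 + t) * 1 + 2 * 1)
      ≡⟨ cong (_+ (2 + t) * V (n + 1 * d) * ((1 + t) * 1 + 2 * 1))
              (cong₂ (λ x y → 2 * ((2 + t) * x + y)) A-zero B-zero) ⟩
    2 * ((2 + t) * 0 + 0) + (2 + t) * V (n + 1 * d) * ((1 + t) * 1 + 2 * 1)
      ≡⟨ collect t (V (n + 1 * d)) ⟩
    V (n + 1 * d) * (3 + t) * (2 + t)
      ≡⟨ cong₂ (λ v c → v * c * (c ∸ 1)) V[n+1*d]≡V[n+d] (sym L[d]≡3+t) ⟩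
    V (n + d) * L d * (L d ∸ 1)
      ∎
    where
    open ≡-Reasoning
    collect : ∀ t v → 2 * ((2 + t) * 0 + 0) + (2 + t) * v * ((1 + t) * 1 + 2 * 1) ≡ v * (3 + t) * (2 + t)
    collect = solve-∀

  2*B-one : 2 * B V n d 1 ≡ V (n + d) * (L d ∸ 1) * (L d ∸ 2)
  2*B-one = begin
    2 * B V n d 1
      ≡⟨ 2*B-suc 0 ⟩
    2 * ((1 + t) * A V n d 0 + B V n d 0) + (1 + t) * V (n + 1 * d) * (t * 1 + 2 * 1)
      ≡⟨ cong (_+ (1 + t) * V (n + 1 * d) * (t * 1 + 2 * 1))
              (cong₂ (λ x y → 2 * ((1 + t) * x + y)) A-zero B-zero) ⟩
    2 * ((1 + t) * 0 + 0) + (1 + t) * V (n + 1 * d) * (t * 1 + 2 * 1)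
      ≡⟨ collect t (V (n + 1 * d)) ⟩
    V (n + 1 * d) * (2 + t) * (1 + t)
      ≡⟨ cong₂ (λ v c → v * (c ∸ 1) * (c ∸ 2)) V[n+1*d]≡V[n+d] (sym L[d]≡3+t) ⟩
    V (n + d) * (L d ∸ 1) * (L d ∸ 2)
      ∎
    where
    open ≡-Reasoning
    collect : ∀ t v → 2 * ((1 + t) * 0 + 0) + (1 + t) * v * (t * 1 + 2 * 1) ≡ v * (2 + t) * (1 + t)
    collect = solve-∀

proposition3p4p3 : (V : ℕ → ℕ) (n d : ℕ)
    → (∀ j → 1 ≤ j → 0 < V j)
    → (∀ j → 3 ≤ j → V j ≡ V (j ∸ 1) + V (j ∸ 2))
    → 1 ≤ n
    → 2 ≤ d
    → ∃ (λ m → d ≡ 2 * m)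
    → gcd (V 1) (V 2) ≡ 1
    → gcd (V n) (F d) ≡ 1
    → ((k : ℕ) → 1 ≤ k
        → (2 * F d * A V n d (suc k)
             ≡ 2 * F d * ((L d ∸ 1) * A V n d k + B V n d k)
               + (L d ∸ 1) * V (n + suc k * d) * (F (suc (suc k) * d) ∸ F (k * d)))
        × (2 * F d * B V n d (suc k)
             ≡ 2 * F d * ((L d ∸ 2) * A V n d k + B V n d k)
               + (L d ∸ 2) * V (n + suc k * d)
                 * (F (suc (suc k) * d) ∸ F (suc k * d) ∸ F (k * d))))
      × (2 * A V n d 1 ≡ V (n + d) * L d * (L d ∸ 1))
      × (2 * B V n d 1 ≡ V (n + d) * (L d ∸ 1) * (L d ∸ 2))
proposition3p4p3 V n d _ _ _ 2≤d d-even _ _ = (λ k _ → A-rec k , B-rec k) , 2*A-one , 2*B-one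
  where open Recurrences V n d 2≤d d-even
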